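{- Let $n\ge 0$ and $k\ge 0$ be integers. Let $RD_{n+2,k}$ be the set of permutations $\pi\in\mathcal{Q}_{n+2}$ with $\mathrm{des}(\pi)=k$ such that, with $a=\pi^{ -1}(1)$, either $a=1$, or $2\le a\le n+1$ and $\pi(a-1)>\pi(a+1)$. Let $FD_{n+1,k}$ be the set of pairs $[\sigma,i]$ with $\sigma\in\mathcal{Q}_{n+1}$, $\mathrm{des}(\sigma)=k$, and $i\in\{0,1,\dots,k\}$. Then there is a bijection from $RD_{n+2,k}$ onto $FD_{n+1,k}$.
   Context: Permutations of $[m]=\{1,\dots,m\}$ are written as words $\pi(1)\cdots\pi(m)$. A descent of $\pi$ is an index $i\in[m-1]$ with $\pi(i)>\pi(i+1)$; $\mathrm{des}(\pi)$ is the number of descents. $\mathcal{Q}_m$ denotes the set of permutations $\pi$ of $[m]$ such that $\pi(1)<\pi(2)<\cdots<\pi(p)$ where $p=\pi^{ -1}(m)$ (i.e. the entry $m$ is the top of the first descent, the identity permutation being included). -}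

module Defs where

open import Data.Nat using (ℕ; zero; suc; _+_; _≡ᵇ_; _<ᵇ_; _≤ᵇ_)
open import Data.Bool using (Bool; true; false; _∧_; _∨_; not; if_then_else_; T)
open import Data.List using (List; []; _∷_; length)
open import Data.Bool.ListAction using (all; any)
open import Data.Fin using (Fin)
open import Data.Product using (Σ; _×_)

-- A permutation of [m] is represented as its word π(1)⋯π(m), a list of
-- naturals with values in {1,…,m} (1-based, as in the paper).

distinct : List ℕ → Bool
distinct []      = true
distinct (x ∷ r) = not (any (λ y → x ≡ᵇ y) r) ∧ distinct r

isPerm : ℕ → List ℕ → Bool
isPerm m w = (length w ≡ᵇ m) ∧ (all (λ x → (1 ≤ᵇ x) ∧ (x ≤ᵇ m)) w ∧ distinct w)

des : List ℕ → ℕ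
des []          = 0
des (x ∷ [])    = 0
des (x ∷ y ∷ r) = (if y <ᵇ x then 1 else 0) + des (y ∷ r)

-- π(1) < π(2) < ⋯ < π(p) where π(p) = m
incToMax : ℕ → List ℕ → Bool
incToMax m []          = true
incToMax m (x ∷ [])    = true
incToMax m (x ∷ y ∷ r) = (x ≡ᵇ m) ∨ ((x <ᵇ y) ∧ incToMax m (y ∷ r))

inQ : ℕ → List ℕ → Bool
inQ m w = isPerm m w ∧ incToMax m w

rdGo : ℕ → List ℕ → Bool
rdGo prev []          = false
rdGo prev (y ∷ [])    = false
rdGo prev (y ∷ z ∷ r) = ((y ≡ᵇ 1) ∧ (z <ᵇ prev)) ∨ rdGo y (z ∷ r)

rdCond : List ℕ → Bool
rdCond []      = false
rdCond (x ∷ r) = (x ≡ᵇ 1) ∨ rdGo x r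

RD : ℕ → ℕ → Set
RD n k = Σ (List ℕ) (λ π → T (inQ (2 + n) π ∧ ((des π ≡ᵇ k) ∧ rdCond π)))

FD : ℕ → ℕ → Set
FD n k = Σ (List ℕ) (λ σ → T (inQ (1 + n) σ ∧ (des σ ≡ᵇ k))) × Fin (suc k)

-- Prefix every word with a sentinel top = n + 3 larger than all its entries, so that
-- des (top ∷ w) = des w + 1. For π ∈ 𝒬_{n+2} the condition on a = π⁻¹(1) says that the
-- two neighbours of 1 in top ∷ π form a descent (for a = 1 the left one is top). Deleting
-- the 1 therefore leaves a word t with des (top ∷ t) = des (top ∷ π) = k + 1, and π is
-- recovered from t by inserting 1 into the i-th of these k + 1 descents, where i counts
-- the descents of top ∷ π before the 1. Lowering the entries of t by one gives σ ∈ 𝒬_{n+1},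
-- since inserting or deleting 1 never touches the increasing run up to the maximum.
module Submission where

open import Defs
open import Algebra.Bundles using (CommutativeMonoid)
open import Data.Bool using (Bool; true; false; _∧_; _∨_; not; if_then_else_; T)
open import Data.Bool.ListAction using (all; any)
open import Data.Bool.Properties
  using (∨-commutativeMonoid; ∧-conicalˡ; ∧-conicalʳ; ∧-identityʳ; T-≡; T-∧; T-irrelevant)
open import Data.Empty using (⊥-elim)
open import Data.Fin using (toℕ; fromℕ<)
open import Data.Fin.Properties using (toℕ-fromℕ<; toℕ<n; toℕ-injective)
open import Data.List using (List; []; _∷_; length; map)
open import Data.List.Properties using (length-map; map-∘; map-id)
import Data.List.Relation.Binary.Permutation.Propositional as ↭
open ↭ using (_↭_; prep; swap; ↭-refl; ↭-trans)
open import Data.List.Relation.Binary.Permutation.Propositional.Properties using (↭-length)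
open import Data.Nat using (ℕ; zero; suc; pred; _+_; _<_; s≤s; z≤n; _≡ᵇ_; _<ᵇ_; _≤ᵇ_)
open import Data.Nat.Properties using (≡ᵇ⇒≡; ≡⇒≡ᵇ; suc-injective; +-monoʳ-<)
open import Data.Product using (_×_; _,_; proj₁; proj₂)
open import Data.Product.Properties using (Σ-≡,≡→≡)
open import Function.Bundles using (_⤖_; Equivalence; mk↔ₛ′)
open import Function.Properties.Inverse using (↔⇒⤖)
open import Relation.Binary.PropositionalEquality
open import Algebra.Properties.CommutativeSemigroup
  (CommutativeMonoid.commutativeSemigroup ∨-commutativeMonoid) using () renaming (x∙yz≈y∙xz to ∨-swap)

≡ᵇ-comm : ∀ m n → (m ≡ᵇ n) ≡ (n ≡ᵇ m)
≡ᵇ-comm zero    zero    = refl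
≡ᵇ-comm zero    (suc n) = refl
≡ᵇ-comm (suc m) zero    = refl
≡ᵇ-comm (suc m) (suc n) = ≡ᵇ-comm m n

<ᵇ-asym : ∀ m n → (m <ᵇ n) ≡ true → (n <ᵇ m) ≡ false
<ᵇ-asym zero    (suc n) _ = refl
<ᵇ-asym (suc m) (suc n) h = <ᵇ-asym m n h

<ᵇ⇒≮ᵇ1 : ∀ m n → (m <ᵇ n) ≡ true → (n <ᵇ 1) ≡ false
<ᵇ⇒≮ᵇ1 m (suc n) _ = refl

suc<ᵇ⇒1<ᵇ : ∀ m n → (suc m <ᵇ n) ≡ true → (1 <ᵇ n) ≡ true
suc<ᵇ⇒1<ᵇ m (suc (suc n)) _ = refl

all-∷⁻ : ∀ (p : ℕ → Bool) y r → T (all p (y ∷ r)) → T (p y) × T (all p r)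
all-∷⁻ p y r = Equivalence.to (T-∧ {p y})

any-↭ : ∀ {A : Set} (f : A → Bool) {xs ys} → xs ↭ ys → any f xs ≡ any f ys
any-↭ f ↭.refl        = refl
any-↭ f (prep x p)    = cong (f x ∨_) (any-↭ f p)
any-↭ f (swap x y p)  = trans (cong (λ b → f x ∨ (f y ∨ b)) (any-↭ f p)) (∨-swap (f x) (f y) _)
any-↭ f (↭.trans p q) = trans (any-↭ f p) (any-↭ f q)

distinct-swap : ∀ x y r → distinct (x ∷ y ∷ r) ≡ distinct (y ∷ x ∷ r)
distinct-swap x y r rewrite ≡ᵇ-comm x y with y ≡ᵇ x | any (x ≡ᵇ_) r | any (y ≡ᵇ_) r
... | true  | _     | _     = refl
... | false | false | _     = refl
... | false | true  | true  = refl
... | false | true  | false = refl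

distinct-↭ : ∀ {xs ys} → xs ↭ ys → distinct xs ≡ distinct ys
distinct-↭ ↭.refl                  = refl
distinct-↭ (prep x p)              = cong₂ (λ a d → not a ∧ d) (any-↭ (x ≡ᵇ_) p) (distinct-↭ p)
distinct-↭ (swap {ys = ys} x y p)
  rewrite any-↭ (x ≡ᵇ_) p | any-↭ (y ≡ᵇ_) p | distinct-↭ p = distinct-swap x y ys
distinct-↭ (↭.trans p q)           = trans (distinct-↭ p) (distinct-↭ q)

Positive : List ℕ → Set
Positive w = T (all (1 ≤ᵇ_) w)

OneFree : List ℕ → Set
OneFree w = T (not (any (1 ≡ᵇ_) w))

-- insertOne j prev t puts 1 between the two entries of the j-th descent (from 0) of prev ∷ t.
insertOne : ℕ → ℕ → List ℕ → List ℕ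
insertOne j prev []      = []
insertOne j prev (y ∷ r) with y <ᵇ prev | j
... | true  | zero   = 1 ∷ y ∷ r
... | true  | suc j′ = y ∷ insertOne j′ y r
... | false | _      = y ∷ insertOne j y r

insertOne-↭ : ∀ j prev t → j < des (prev ∷ t) → insertOne j prev t ↭ 1 ∷ t
insertOne-↭ j prev (y ∷ r) j<d with y <ᵇ prev | j | j<d
... | true  | zero   | _        = ↭-refl
... | true  | suc j′ | s≤s j′<d = ↭-trans (prep y (insertOne-↭ j′ y r j′<d)) (swap y 1 ↭-refl)
... | false | i      | i<d      = ↭-trans (prep y (insertOne-↭ i y r i<d)) (swap y 1 ↭-refl)

all-insertOne : ∀ (p : ℕ → Bool) j prev t → p 1 ≡ true → all p (insertOne j prev t) ≡ all p t
all-insertOne p j prev []      _  = refl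
all-insertOne p j prev (y ∷ r) p1 with y <ᵇ prev | j
... | true  | zero   rewrite p1 = refl
... | true  | suc j′ = cong (p y ∧_) (all-insertOne p j′ y r p1)
... | false | i      = cong (p y ∧_) (all-insertOne p i y r p1)

incToMax-insertOne-after : ∀ m j prev t →
                           incToMax m (prev ∷ insertOne j prev t) ≡ incToMax m (prev ∷ t)
incToMax-insertOne-after m j prev []      = refl
incToMax-insertOne-after m j prev (y ∷ r) with y <ᵇ prev in descent | j
... | true  | zero   rewrite <ᵇ⇒≮ᵇ1 y prev descent | <ᵇ-asym y prev descent = refl
... | true  | suc j′ rewrite <ᵇ-asym y prev descent = refl
... | false | i      = cong (λ b → (prev ≡ᵇ m) ∨ ((prev <ᵇ y) ∧ b)) (incToMax-insertOne-after m i y r)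

incToMax-insertOne : ∀ m j prev t → Positive t → OneFree t →
                     incToMax (2 + m) (insertOne j prev t) ≡ incToMax (2 + m) t
incToMax-insertOne m j prev []                _ _ = refl
incToMax-insertOne m j prev (suc (suc y) ∷ r) _ _ with suc (suc y) <ᵇ prev | j
... | true  | zero   = refl
... | true  | suc j′ = incToMax-insertOne-after (2 + m) j′ (suc (suc y)) r
... | false | i      = incToMax-insertOne-after (2 + m) i (suc (suc y)) r

des-insertOne : ∀ j prev t → Positive t → des (prev ∷ insertOne j prev t) ≡ des (prev ∷ t)
des-insertOne j prev []          _   = refl
des-insertOne j prev (suc y ∷ r) pos with suc y <ᵇ prev in descent | j
... | true  | zero   rewrite suc<ᵇ⇒1<ᵇ y prev descent = refl
... | true  | suc j′ rewrite descent = cong suc (des-insertOne j′ (suc y) r pos)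
... | false | i      rewrite descent = des-insertOne i (suc y) r pos

rdGo-∷ : ∀ prev y l → T (rdGo y l) → T (rdGo prev (y ∷ l))
rdGo-∷ prev y (z ∷ l) h with (y ≡ᵇ 1) ∧ (z <ᵇ prev)
... | true  = _
... | false = h

rdGo-insertOne : ∀ j prev t → j < des (prev ∷ t) → T (rdGo prev (insertOne j prev t))
rdGo-insertOne j prev (y ∷ r) j<d with y <ᵇ prev in descent | j | j<d
... | true  | zero   | _        rewrite descent = _
... | true  | suc j′ | s≤s j′<d = rdGo-∷ prev y (insertOne j′ y r) (rdGo-insertOne j′ y r j′<d)
... | false | i      | i<d      = rdGo-∷ prev y (insertOne i y r) (rdGo-insertOne i y r i<d)

headBelow : ℕ → List ℕ → Bool
headBelow prev []      = false
headBelow prev (z ∷ _) = z <ᵇ prev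

-- removeOne prev r deletes the first 1 of r whose left neighbour in prev ∷ r exceeds its right
-- one (the condition of rdGo), and oneIndex prev r counts the descents of prev ∷ r before it.
removeOne : ℕ → List ℕ → List ℕ
removeOne prev []      = []
removeOne prev (y ∷ r) = if (y ≡ᵇ 1) ∧ headBelow prev r then r else y ∷ removeOne y r

oneIndex : ℕ → List ℕ → ℕ
oneIndex prev []      = 0
oneIndex prev (y ∷ r) =
  if (y ≡ᵇ 1) ∧ headBelow prev r then 0 else (if y <ᵇ prev then 1 else 0) + oneIndex y r

valley-inv : ∀ prev y z → (y ≡ᵇ 1) ∧ (z <ᵇ prev) ≡ true → y ≡ 1 × (z <ᵇ prev) ≡ true
valley-inv prev y z valley =
  ≡ᵇ⇒≡ y 1 (Equivalence.from T-≡ (∧-conicalˡ (y ≡ᵇ 1) (z <ᵇ prev) valley)) ,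
  ∧-conicalʳ (y ≡ᵇ 1) (z <ᵇ prev) valley

oneFree-∷⁻ : ∀ y r → OneFree (y ∷ r) → (y ≡ᵇ 1) ≡ false × OneFree r
oneFree-∷⁻ y r h rewrite ≡ᵇ-comm y 1 with 1 ≡ᵇ y
... | true  = ⊥-elim h
... | false = refl , h

removeOne-insertOne : ∀ j prev t → OneFree t → j < des (prev ∷ t) →
                      removeOne prev (insertOne j prev t) ≡ t
removeOne-insertOne j prev (y ∷ r) free j<d with oneFree-∷⁻ y r free | y <ᵇ prev in descent | j | j<d
... | _           | true  | zero   | _        rewrite descent = refl
... | y≢1 , free′ | true  | suc j′ | s≤s j′<d rewrite y≢1 =
  cong (y ∷_) (removeOne-insertOne j′ y r free′ j′<d)
... | y≢1 , free′ | false | i      | i<d      rewrite y≢1 =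
  cong (y ∷_) (removeOne-insertOne i y r free′ i<d)

oneIndex-insertOne : ∀ j prev t → OneFree t → j < des (prev ∷ t) →
                     oneIndex prev (insertOne j prev t) ≡ j
oneIndex-insertOne j prev (y ∷ r) free j<d with oneFree-∷⁻ y r free | y <ᵇ prev in descent | j | j<d
... | _           | true  | zero   | _        rewrite descent = refl
... | y≢1 , free′ | true  | suc j′ | s≤s j′<d rewrite y≢1 | descent =
  cong suc (oneIndex-insertOne j′ y r free′ j′<d)
... | y≢1 , free′ | false | i      | i<d      rewrite y≢1 | descent =
  oneIndex-insertOne i y r free′ i<d

insertOne-∷ : ∀ i prev y t →
              insertOne ((if y <ᵇ prev then 1 else 0) + i) prev (y ∷ t) ≡ y ∷ insertOne i y t
insertOne-∷ i prev y t with y <ᵇ prev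
... | true  = refl
... | false = refl

insertOne-valley : ∀ prev y z r → (y ≡ᵇ 1) ∧ (z <ᵇ prev) ≡ true →
                   insertOne 0 prev (z ∷ r) ≡ y ∷ z ∷ r
insertOne-valley prev y z r valley with valley-inv prev y z valley
... | refl , descent rewrite descent = refl

-- In the next two proofs the recursive call is abstracted by the with, so that the
-- termination checker sees it applied to the subterm z ∷ r.
insertOne-removeOne : ∀ prev r → T (rdGo prev r) →
                      insertOne (oneIndex prev r) prev (removeOne prev r) ≡ r
insertOne-removeOne prev (y ∷ z ∷ r) h
  with (y ≡ᵇ 1) ∧ (z <ᵇ prev) in valley | insertOne-removeOne y (z ∷ r)
... | true  | _  = insertOne-valley prev y z r valley
... | false | ih = trans (insertOne-∷ _ prev y _) (cong (y ∷_) (ih h))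

des-valley : ∀ prev y z r → (y ≡ᵇ 1) ∧ (z <ᵇ prev) ≡ true → Positive (y ∷ z ∷ r) →
             0 < des (prev ∷ y ∷ z ∷ r)
des-valley prev y z r valley pos with valley-inv prev y z valley
des-valley prev _ (suc z) r valley pos | refl , descent rewrite suc<ᵇ⇒1<ᵇ z prev descent = s≤s z≤n

oneIndex<des : ∀ prev r → T (rdGo prev r) → Positive r → oneIndex prev r < des (prev ∷ r)
oneIndex<des prev (y ∷ z ∷ r) h pos
  with (y ≡ᵇ 1) ∧ (z <ᵇ prev) in valley | oneIndex<des y (z ∷ r)
... | true  | _  = des-valley prev y z r valley pos
... | false | ih = +-monoʳ-< (if y <ᵇ prev then 1 else 0) (ih h (proj₂ (all-∷⁻ (1 ≤ᵇ_) y (z ∷ r) pos)))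

des-removeOne : ∀ prev π → T (rdGo prev π) → Positive (removeOne prev π) →
                des (prev ∷ removeOne prev π) ≡ des (prev ∷ π)
des-removeOne prev π valley pos =
  trans (sym (des-insertOne (oneIndex prev π) prev (removeOne prev π) pos))
        (cong (λ w → des (prev ∷ w)) (insertOne-removeOne prev π valley))

inRange : ℕ → ℕ → Bool
inRange M x = (1 ≤ᵇ x) ∧ (x ≤ᵇ M)

-- QWord m m w is membership of w in 𝒬_m. The length is kept apart from the range of the
-- entries because the word between RD and FD has length n + 1 and entries in [2, n + 2].
record QWord (ℓ M : ℕ) (w : List ℕ) : Set where
  field
    length≡    : length w ≡ ℓ
    entries    : T (all (inRange M) w)
    isDistinct : T (distinct w)
    risesToMax : T (incToMax M w)

qword : ∀ m w → T (inQ m w) → QWord m m w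
qword m w h =
  let perm , rises = Equivalence.to (T-∧ {isPerm m w}) h
      len , range  = Equivalence.to (T-∧ {length w ≡ᵇ m}) perm
      ent , dst    = Equivalence.to (T-∧ {all (inRange m) w}) range
  in record { length≡ = ≡ᵇ⇒≡ _ _ len ; entries = ent ; isDistinct = dst ; risesToMax = rises }

inQ-qword : ∀ {m w} → QWord m m w → T (inQ m w)
inQ-qword q = Equivalence.from T-∧
  (Equivalence.from T-∧ (≡⇒≡ᵇ _ _ length≡ , Equivalence.from T-∧ (entries , isDistinct)) , risesToMax)
  where open QWord q

inRange⇒positive : ∀ M w → T (all (inRange M) w) → Positive w
inRange⇒positive M []          _ = _
inRange⇒positive M (suc x ∷ w) h = inRange⇒positive M w (proj₂ (all-∷⁻ (inRange M) (suc x) w h))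

QWord-insertOne : ∀ {ℓ m t} j prev → QWord ℓ (2 + m) t → OneFree t → j < des (prev ∷ t) →
                  QWord (suc ℓ) (2 + m) (insertOne j prev t)
QWord-insertOne {m = m} {t} j prev q free j<d = record
  { length≡    = trans (↭-length perm) (cong suc length≡)
  ; entries    = subst T (sym (all-insertOne (inRange (2 + m)) j prev t refl)) entries
  ; isDistinct = subst T (sym (distinct-↭ perm)) (Equivalence.from T-∧ (free , isDistinct))
  ; risesToMax = subst T (sym (incToMax-insertOne m j prev t (inRange⇒positive _ t entries) free))
                         risesToMax
  }
  where
  open QWord q
  perm = insertOne-↭ j prev t j<d

QWord-removeOne : ∀ {ℓ m π} prev → QWord (suc ℓ) (2 + m) π → T (rdGo prev π) →
                  QWord ℓ (2 + m) (removeOne prev π) × OneFree (removeOne prev π)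
QWord-removeOne {ℓ} {m} {π} prev q valley = record
  { length≡    = suc-injective (trans (sym (↭-length perm)) (trans (cong length π≡) length≡))
  ; entries    = entriesₜ
  ; isDistinct = proj₂ free×distinct
  ; risesToMax = subst T (trans (cong (incToMax (2 + m)) (sym π≡))
                                (incToMax-insertOne m j prev t posₜ (proj₁ free×distinct)))
                         risesToMax
  } , proj₁ free×distinct
  where
  open QWord q
  t = removeOne prev π
  j = oneIndex prev π
  π≡ : insertOne j prev t ≡ π
  π≡ = insertOne-removeOne prev π valley
  entriesₜ : T (all (inRange (2 + m)) t)
  entriesₜ = subst T (trans (cong (all (inRange (2 + m))) (sym π≡))
                            (all-insertOne (inRange (2 + m)) j prev t refl))
                     entries
  posₜ = inRange⇒positive _ t entriesₜ
  j<d : j < des (prev ∷ t)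
  j<d = subst (j <_) (sym (des-removeOne prev π valley posₜ))
              (oneIndex<des prev π valley (inRange⇒positive _ π entries))
  perm = insertOne-↭ j prev t j<d
  free×distinct = Equivalence.to (T-∧ {not (any (1 ≡ᵇ_) t)})
                    (subst T (trans (cong distinct (sym π≡)) (distinct-↭ perm)) isDistinct)

des-map-suc : ∀ σ → des (map suc σ) ≡ des σ
des-map-suc []          = refl
des-map-suc (x ∷ [])    = refl
des-map-suc (x ∷ y ∷ σ) = cong ((if y <ᵇ x then 1 else 0) +_) (des-map-suc (y ∷ σ))

any-map-suc : ∀ x σ → any (suc x ≡ᵇ_) (map suc σ) ≡ any (x ≡ᵇ_) σ
any-map-suc x []      = refl
any-map-suc x (y ∷ σ) = cong ((x ≡ᵇ y) ∨_) (any-map-suc x σ)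

distinct-map-suc : ∀ σ → distinct (map suc σ) ≡ distinct σ
distinct-map-suc []      = refl
distinct-map-suc (x ∷ σ) = cong₂ (λ a d → not a ∧ d) (any-map-suc x σ) (distinct-map-suc σ)

incToMax-map-suc : ∀ m σ → incToMax (suc m) (map suc σ) ≡ incToMax m σ
incToMax-map-suc m []          = refl
incToMax-map-suc m (x ∷ [])    = refl
incToMax-map-suc m (x ∷ y ∷ σ) =
  cong (λ b → (x ≡ᵇ m) ∨ ((x <ᵇ y) ∧ b)) (incToMax-map-suc m (y ∷ σ))

map-pred-map-suc : ∀ σ → map pred (map suc σ) ≡ σ
map-pred-map-suc σ = trans (sym (map-∘ σ)) (map-id σ)

map-suc-map-pred : ∀ w → Positive w → map suc (map pred w) ≡ w
map-suc-map-pred []          _   = refl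
map-suc-map-pred (suc x ∷ w) pos = cong (suc x ∷_) (map-suc-map-pred w pos)

map-suc-inRange : ∀ M σ → T (all (inRange M) σ) →
                  T (all (inRange (suc M)) (map suc σ)) × OneFree (map suc σ)
map-suc-inRange M []          _ = _ , _
map-suc-inRange M (suc x ∷ σ) h with x <ᵇ M
... | true  = map-suc-inRange M σ h
... | false = ⊥-elim h

map-pred-inRange : ∀ M w → T (all (inRange (suc M)) w) → OneFree w → T (all (inRange M) (map pred w))
map-pred-inRange M []                _ _    = _
map-pred-inRange M (suc (suc x) ∷ w) h free with x <ᵇ M
... | true  = map-pred-inRange M w h free
... | false = ⊥-elim h

inRange⇒<ᵇsuc : ∀ M y → T (inRange M y) → (y <ᵇ suc M) ≡ true
inRange⇒<ᵇsuc M (suc x) h = Equivalence.to T-≡ h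

des-top : ∀ {ℓ} M w → length w ≡ suc ℓ → T (all (inRange M) w) → des (suc M ∷ w) ≡ suc (des w)
des-top M (y ∷ r) _ ent rewrite inRange⇒<ᵇsuc M y (proj₁ (all-∷⁻ (inRange M) y r ent)) = refl

rdGo-top : ∀ {ℓ} M w → length w ≡ 2 + ℓ → T (all (inRange M) w) → rdGo (suc M) w ≡ rdCond w
rdGo-top M (x ∷ z ∷ r) _ ent
  rewrite inRange⇒<ᵇsuc M z (proj₁ (all-∷⁻ (inRange M) z r (proj₂ (all-∷⁻ (inRange M) x (z ∷ r) ent))))
  = cong (_∨ rdGo x (z ∷ r)) (∧-identityʳ (x ≡ᵇ 1))

IsRD : ℕ → ℕ → List ℕ → Set
IsRD n k π = T (inQ (2 + n) π ∧ ((des π ≡ᵇ k) ∧ rdCond π))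

IsFD : ℕ → ℕ → List ℕ → Set
IsFD n k σ = T (inQ (1 + n) σ ∧ (des σ ≡ᵇ k))

record Lifted (n k : ℕ) (t : List ℕ) : Set where
  field
    word    : QWord (suc n) (2 + n) t
    oneFree : OneFree t
    des≡    : des t ≡ k

module _ (n k : ℕ) where

  top : ℕ
  top = 3 + n

  lift : ∀ σ → IsFD n k σ → Lifted n k (map suc σ)
  lift σ h = record
    { word    = record
      { length≡    = trans (length-map suc σ) length≡
      ; entries    = proj₁ range
      ; isDistinct = subst T (sym (distinct-map-suc σ)) isDistinct
      ; risesToMax = subst T (sym (incToMax-map-suc (suc n) σ)) risesToMax
      }
    ; oneFree = proj₂ range
    ; des≡    = trans (des-map-suc σ) (≡ᵇ⇒≡ _ _ (proj₂ inQ×des))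
    }
    where
    inQ×des = Equivalence.to (T-∧ {inQ (1 + n) σ}) h
    open QWord (qword (1 + n) σ (proj₁ inQ×des))
    range = map-suc-inRange (suc n) σ entries

  lower : ∀ t → Lifted n k t → IsFD n k (map pred t)
  lower t l = Equivalence.from T-∧ (inQ-qword q , ≡⇒≡ᵇ _ _ desσ)
    where
    open Lifted l
    open QWord word
    t≡ : map suc (map pred t) ≡ t
    t≡ = map-suc-map-pred t (inRange⇒positive (2 + n) t entries)
    q : QWord (suc n) (suc n) (map pred t)
    q = record
      { length≡    = trans (length-map pred t) length≡
      ; entries    = map-pred-inRange (suc n) t entries oneFree
      ; isDistinct = subst T (trans (cong distinct (sym t≡)) (distinct-map-suc (map pred t)))
                             isDistinct
      ; risesToMax = subst T (trans (cong (incToMax (2 + n)) (sym t≡)) (incToMax-map-suc (suc n) (map pred t)))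
                             risesToMax
      }
    desσ : des (map pred t) ≡ k
    desσ = trans (sym (des-map-suc (map pred t))) (trans (cong des t≡) des≡)

  Lifted-des-top : ∀ t → Lifted n k t → des (top ∷ t) ≡ suc k
  Lifted-des-top t l = trans (des-top (2 + n) t length≡ entries) (cong suc des≡)
    where
    open Lifted l
    open QWord word

  IsRD-top : ∀ π → IsRD n k π → QWord (2 + n) (2 + n) π × des (top ∷ π) ≡ suc k × T (rdGo top π)
  IsRD-top π h = q , trans (des-top (2 + n) π length≡ entries) (cong suc (≡ᵇ⇒≡ _ _ (proj₁ des×rd))) ,
                 subst T (sym (rdGo-top (2 + n) π length≡ entries)) (proj₂ des×rd)
    where
    inQ×rest = Equivalence.to (T-∧ {inQ (2 + n) π}) h
    q = qword (2 + n) π (proj₁ inQ×rest)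
    open QWord q
    des×rd = Equivalence.to (T-∧ {des π ≡ᵇ k}) (proj₂ inQ×rest)

  insertOne-RD : ∀ t j → Lifted n k t → j < suc k → IsRD n k (insertOne j top t)
  insertOne-RD t j l j<k = Equivalence.from T-∧ (inQ-qword q , Equivalence.from T-∧
    (≡⇒≡ᵇ _ _ desπ , subst T (rdGo-top (2 + n) π length≡π entriesπ) (rdGo-insertOne j top t j<d)))
    where
    open Lifted l
    open QWord word
    π = insertOne j top t
    j<d : j < des (top ∷ t)
    j<d = subst (j <_) (sym (Lifted-des-top t l)) j<k
    q = QWord-insertOne j top word oneFree j<d
    open QWord q using () renaming (length≡ to length≡π; entries to entriesπ)
    desπ : des π ≡ k
    desπ = suc-injective (begin
      suc (des π)     ≡⟨ des-top (2 + n) π length≡π entriesπ ⟨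
      des (top ∷ π)   ≡⟨ des-insertOne j top t (inRange⇒positive _ t entries) ⟩
      des (top ∷ t)   ≡⟨ Lifted-des-top t l ⟩
      suc k           ∎)
      where open ≡-Reasoning

  removeOne-Lifted : ∀ π → IsRD n k π → Lifted n k (removeOne top π) × oneIndex top π < suc k
  removeOne-Lifted π h = record { word = qₜ ; oneFree = free ; des≡ = desₜ } , j<k
    where
    q×des×valley = IsRD-top π h
    q = proj₁ q×des×valley
    desπ = proj₁ (proj₂ q×des×valley)
    valley = proj₂ (proj₂ q×des×valley)
    open QWord q
    t = removeOne top π
    j<k : oneIndex top π < suc k
    j<k = subst (oneIndex top π <_) desπ (oneIndex<des top π valley (inRange⇒positive _ π entries))
    qₜ×free = QWord-removeOne top q valley
    qₜ = proj₁ qₜ×free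
    free = proj₂ qₜ×free
    open QWord qₜ using () renaming (length≡ to length≡ₜ; entries to entriesₜ)
    desₜ : des t ≡ k
    desₜ = suc-injective (begin
      suc (des t)     ≡⟨ des-top (2 + n) t length≡ₜ entriesₜ ⟨
      des (top ∷ t)   ≡⟨ des-removeOne top π valley (inRange⇒positive _ t entriesₜ) ⟩
      des (top ∷ π)   ≡⟨ desπ ⟩
      suc k           ∎)
      where open ≡-Reasoning

  toFD : RD n k → FD n k
  toFD (π , h) = (map pred (removeOne top π) , lower (removeOne top π) (proj₁ r)) , fromℕ< (proj₂ r)
    where r = removeOne-Lifted π h

  toRD : FD n k → RD n k
  toRD ((σ , h) , i) =
    insertOne (toℕ i) top (map suc σ) , insertOne-RD (map suc σ) (toℕ i) (lift σ h) (toℕ<n i)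

  toFD∘toRD : ∀ x → toFD (toRD x) ≡ x
  toFD∘toRD ((σ , h) , i) =
    cong₂ _,_ (Σ-≡,≡→≡ (σ≡ , T-irrelevant _ _)) (toℕ-injective (trans (toℕ-fromℕ< _) i≡))
    where
    t = map suc σ
    free = Lifted.oneFree (lift σ h)
    j<d : toℕ i < des (top ∷ t)
    j<d = subst (toℕ i <_) (sym (Lifted-des-top t (lift σ h))) (toℕ<n i)
    σ≡ : map pred (removeOne top (insertOne (toℕ i) top t)) ≡ σ
    σ≡ = trans (cong (map pred) (removeOne-insertOne (toℕ i) top t free j<d)) (map-pred-map-suc σ)
    i≡ : oneIndex top (insertOne (toℕ i) top t) ≡ toℕ i
    i≡ = oneIndex-insertOne (toℕ i) top t free j<d

  toRD∘toFD : ∀ x → toRD (toFD x) ≡ x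
  toRD∘toFD (π , h) = Σ-≡,≡→≡ (π≡ , T-irrelevant _ _)
    where
    t = removeOne top π
    r = removeOne-Lifted π h
    pos = inRange⇒positive _ t (QWord.entries (Lifted.word (proj₁ r)))
    π≡ : insertOne (toℕ (fromℕ< (proj₂ r))) top (map suc (map pred t)) ≡ π
    π≡ = begin
      insertOne (toℕ (fromℕ< (proj₂ r))) top (map suc (map pred t))
        ≡⟨ cong₂ (λ j w → insertOne j top w) (toℕ-fromℕ< (proj₂ r)) (map-suc-map-pred t pos) ⟩
      insertOne (oneIndex top π) top t
        ≡⟨ insertOne-removeOne top π (proj₂ (proj₂ (IsRD-top π h))) ⟩
      π ∎
      where open ≡-Reasoning

lemma2p2 : (n k : ℕ) → RD n k ⤖ FD n k
lemma2p2 n k = ↔⇒⤖ (mk↔ₛ′ (toFD n k) (toRD n k) (toFD∘toRD n k) (toRD∘toFD n k))
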